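{- Let $m\in\mathbb{N}$, let $a\in\mathrm{R}_m$ be a regular residue modulo $m$, and let $k\in\mathbb{N}$. Then the congruence $x^k\equiv a \pmod m$ is solvable for $x\in\mathbb{Z}_m$ if and only if \[ a^{\frac{\omega_m(a)}{(k,\omega_m(a))}} \bmod m \in \mathrm{E}_m. \]
   Context: $\mathbb{N}=\{1,2,3,\dots\}$. For $m\in\mathbb{N}$, $\mathbb{Z}_m=\{1,\dots,m\}$, and $a \bmod m$ denotes the unique $b\in\mathbb{Z}_m$ with $a\equiv b\pmod m$. $(u,v)$ denotes the greatest common divisor. $\mathrm{E}_m=\{e\in\mathbb{Z}_m : e^2\equiv e \pmod m\}$ is the set of idempotent residues. For $a\in\mathbb{Z}$, the order $|a|_m$ is the smallest $n\in\mathbb{N}$ with $a^n \bmod m\in\mathrm{E}_m$ (it exists since $a^{\varphi(m)}\bmod m\in \mathrm{E}_m$). A residue $a\in\mathbb{Z}_m$ is regular if $a^{|a|_m+1}\equiv a\pmod m$; $\mathrm{R}_m$ is the set of regular residues. For $a,b\in\mathbb{Z}_m$, we say the index $\mathrm{ind}_b^m a$ exists if there is $n\in\mathbb{N}$ with $b^n\equiv a\pmod m$ (the index being the smallest such $n$). For $a\in\mathrm{R}_m$, the primitive order is $\omega_m(a)=\max\{|b|_m : b\in\mathrm{R}_m,\ \mathrm{ind}_b^m a \text{ exists}\}$. -}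

module Defs where

open import Data.Nat using (ℕ; zero; suc; _+_; _*_; _^_; _≤_; _<_; NonZero; ≢-nonZero; ≢-nonZero⁻¹)
open import Data.Nat.DivMod using (_%_; _/_)
open import Data.Nat.GCD using (gcd; gcd[m,n]≢0)
open import Data.Product using (Σ; ∃; _×_; _,_)
open import Data.Sum using (inj₁)
open import Relation.Binary.PropositionalEquality using (_≡_)
open import Relation.Nullary using (¬_)

infix 4 _≋_[mod_]
_≋_[mod_] : ℕ → ℕ → (m : ℕ) → .{{NonZero m}} → Set
a ≋ b [mod m ] = a % m ≡ b % m

InZ : ℕ → ℕ → Set
InZ m x = 1 ≤ x × x ≤ m

-- a mod m : the unique representative of a in ℤ_m = {1,…,m}
modZ : (m : ℕ) → .{{NonZero m}} → ℕ → ℕ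
modZ m a with a % m
... | zero  = m
... | suc r = suc r

InE : (m : ℕ) → .{{NonZero m}} → ℕ → Set
InE m e = InZ m e × (e * e ≋ e [mod m ])

IsOrder : (m : ℕ) → .{{NonZero m}} → ℕ → ℕ → Set
IsOrder m a n =
  1 ≤ n × InE m (modZ m (a ^ n)) ×
  (∀ j → 1 ≤ j → j < n → ¬ InE m (modZ m (a ^ j)))

InR : (m : ℕ) → .{{NonZero m}} → ℕ → Set
InR m a = InZ m a × Σ ℕ (λ n → IsOrder m a n × (a ^ (n + 1) ≋ a [mod m ]))

IndExists : (m : ℕ) → .{{NonZero m}} → ℕ → ℕ → Set
IndExists m b a = Σ ℕ (λ n → 1 ≤ n × (b ^ n ≋ a [mod m ]))

InOmegaSet : (m : ℕ) → .{{NonZero m}} → ℕ → ℕ → Set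
InOmegaSet m a n = Σ ℕ (λ b → InR m b × IndExists m b a × IsOrder m b n)

-- IsPrimOrder m a w : w = ω_m(a) = max of the above set
IsPrimOrder : (m : ℕ) → .{{NonZero m}} → ℕ → ℕ → Set
IsPrimOrder m a w = InOmegaSet m a w × (∀ n → InOmegaSet m a n → n ≤ w)

expo : (k : ℕ) → .{{NonZero k}} → ℕ → ℕ
expo k w = _/_ w (gcd k w) {{≢-nonZero (gcd[m,n]≢0 k w (inj₁ (≢-nonZero⁻¹ k)))}}

module Submission where

-- Let b be a regular residue of maximal order ω = ω_m(a) among those having a
-- as a power, say b^n ≡ a, and put E = ω / gcd(k, ω).  Writing Idem e for
-- e² ≡ e (mod m), the two directions are:
--
-- (⇐) If a^E is idempotent then b^(nE) is, so ω ∣ nE, i.e. gcd(k, ω) ∣ n; with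
--     Bézout's u·k ≡ gcd(k, ω) (mod ω) the residue b^(u·n/gcd(k, ω)) is a root.
-- (⇒) A root x of x^k ≡ a can be replaced by a regular root y (a suitable power
--     of x).  The key lemma root-order-∣ shows that the order r of y divides ω:
--     otherwise a coprime splitting P ∣ r, β ∣ P, β < P, ω = β·Q, gcd(P, Q) = 1
--     yields the residue y^(r/P)·b^β, whose order is a multiple of P·Q > ω and
--     which still has a as a power, contradicting the maximality of ω.  Then
--     a^E ≡ y^(kE) is idempotent because r ∣ ω ∣ k·E.

open import Defs
open import Data.Nat using (ℕ; zero; suc; pred; _+_; _*_; _∸_; _^_; _≤_; _<_; z≤n; s≤s; ∣_-_∣;
  NonZero; NonTrivial; >-nonZero; >-nonZero⁻¹; ≢-nonZero; ≢-nonZero⁻¹; n>1⇒nonTrivial)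
open import Data.Nat.Properties
open import Data.Nat.DivMod
open import Data.Nat.Divisibility
open import Data.Nat.GCD using (gcd; gcd-GCD; gcd[m,n]∣m; gcd[m,n]∣n; gcd[m,n]≢0; gcd-greatest; module Bézout)
open import Data.Nat.Coprimality using (Coprime; coprime?; coprime-divisor; coprime⇒gcd≡1; gcd≡1⇒coprime)
  renaming (sym to coprime-sym)
open import Data.Nat.Induction using (<-rec)
open import Data.Nat.Tactic.RingSolver using (solve-∀)
open import Data.Product using (Σ; ∃; _×_; _,_; proj₁; proj₂)
open import Data.Sum using (_⊎_; inj₁; inj₂; [_,_]′)
open import Function.Bundles using (_⇔_; mk⇔)
open import Function.Base using (it)
open import Relation.Nullary using (contradiction; ¬_; Dec; yes; no)
open import Relation.Unary using (Decidable)
open import Relation.Binary.PropositionalEquality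
open import Relation.Binary.Bundles using (Setoid)
import Relation.Binary.Reasoning.Setoid as SetoidReasoning

+-nonZeroˡ : ∀ m n → .{{NonZero m}} → NonZero (m + n)
+-nonZeroˡ m n = >-nonZero (≤-trans (>-nonZero⁻¹ m) (m≤m+n m n))

+-nonZeroʳ : ∀ m n → .{{NonZero n}} → NonZero (m + n)
+-nonZeroʳ m n = >-nonZero (≤-trans (>-nonZero⁻¹ n) (m≤n+m n m))

module Congruence (n : ℕ) .{{_ : NonZero n}} where

  infix 4 _≈_
  _≈_ : ℕ → ℕ → Set
  x ≈ y = x ≋ y [mod n ]

  ≈-setoid : Setoid _ _
  ≈-setoid = record
    { Carrier = ℕ ; _≈_ = _≈_
    ; isEquivalence = record { refl = refl ; sym = sym ; trans = trans } }

  module ≈-Reasoning = SetoidReasoning ≈-setoid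

  *-cong : ∀ {a a′ b b′} → a ≈ a′ → b ≈ b′ → a * b ≈ a′ * b′
  *-cong {a} {a′} {b} {b′} a≈a′ b≈b′ = begin
    (a * b) % n                ≡⟨ %-distribˡ-* a b n ⟩
    (a % n * (b % n)) % n      ≡⟨ cong₂ (λ x y → (x * y) % n) a≈a′ b≈b′ ⟩
    (a′ % n * (b′ % n)) % n    ≡⟨ %-distribˡ-* a′ b′ n ⟨
    (a′ * b′) % n              ∎
    where open ≡-Reasoning

  ^-cong : ∀ {a a′} → a ≈ a′ → ∀ e → a ^ e ≈ a′ ^ e
  ^-cong a≈a′ zero    = refl
  ^-cong a≈a′ (suc e) = *-cong a≈a′ (^-cong a≈a′ e)

  +-multipleʳ : ∀ x {y} → n ∣ y → x + y ≈ x
  +-multipleʳ x n∣y = %-remove-+ʳ x n∣y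

  ≈⇒∣∣-∣ : ∀ {x y} → x ≈ y → n ∣ ∣ x - y ∣
  ≈⇒∣∣-∣ {x} {y} x≈y = divides ∣ x / n - y / n ∣ (begin
    ∣ x - y ∣                                  ≡⟨ cong₂ ∣_-_∣ (m≡m%n+[m/n]*n x n) (m≡m%n+[m/n]*n y n) ⟩
    ∣ x % n + x / n * n - y % n + y / n * n ∣  ≡⟨ cong (λ r → ∣ x % n + x / n * n - r + y / n * n ∣) (sym x≈y) ⟩
    ∣ x % n + x / n * n - x % n + y / n * n ∣  ≡⟨ ∣m+n-m+o∣≡∣n-o∣ (x % n) (x / n * n) (y / n * n) ⟩
    ∣ x / n * n - y / n * n ∣                  ≡⟨ *-distribʳ-∣-∣ n (x / n) (y / n) ⟨
    ∣ x / n - y / n ∣ * n                      ∎)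
    where open ≡-Reasoning

  ∣∣-∣⇒≈ : ∀ {x y} → n ∣ ∣ x - y ∣ → x ≈ y
  ∣∣-∣⇒≈ {x} {y} n∣d with ≤-total y x
  ... | inj₁ y≤x = subst (_≈ y) (m+[n∸m]≡n y≤x) (+-multipleʳ y (subst (n ∣_) (m≤n⇒∣n-m∣≡n∸m y≤x) n∣d))
  ... | inj₂ x≤y = sym (subst (_≈ x) (m+[n∸m]≡n x≤y) (+-multipleʳ x (subst (n ∣_) (m≤n⇒∣m-n∣≡n∸m x≤y) n∣d)))

  ≈⇒offsets : ∀ {x y} → x ≈ y → x + n * (y / n) ≡ y + n * (x / n)
  ≈⇒offsets {x} {y} x≈y = begin
    x + n * (y / n)                    ≡⟨ cong (_+ n * (y / n)) (m≡m%n+[m/n]*n x n) ⟩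
    x % n + x / n * n + n * (y / n)    ≡⟨ cong (λ r → r + x / n * n + n * (y / n)) x≈y ⟩
    y % n + x / n * n + n * (y / n)    ≡⟨ swap (y % n) (x / n) (y / n) n ⟩
    y % n + y / n * n + n * (x / n)    ≡⟨ cong (_+ n * (x / n)) (m≡m%n+[m/n]*n y n) ⟨
    y + n * (x / n)                    ∎
    where
      open ≡-Reasoning
      swap : ∀ r a b n → r + a * n + n * b ≡ r + b * n + n * a
      swap = solve-∀

coprime-∣-product : ∀ {P Q d} → Coprime P Q → P ∣ d → Q ∣ d → P * Q ∣ d
coprime-∣-product {P} {Q} cop (divides c refl) Q∣cP =
  subst (P * Q ∣_) (*-comm P c)
    (*-monoʳ-∣ P (coprime-divisor (coprime-sym cop) (subst (Q ∣_) (*-comm c P) Q∣cP)))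

bezout-multiple : ∀ k w .{{_ : NonZero w}} → ∃ λ u → u * k ≋ gcd k w [mod w ]
bezout-multiple k w with Bézout.identity (gcd-GCD k w)
... | Bézout.+- x y eq = x , (begin
    x * k          ≡⟨ eq ⟨
    d + y * w      ≈⟨ +-multipleʳ d (n∣m*n y) ⟩
    d              ∎)
  where
    open Congruence w; open ≈-Reasoning
    d : ℕ
    d = gcd k w
... | Bézout.-+ x y eq = x * pred w , (begin
    x * pred w * k                ≈⟨ +-multipleʳ (x * pred w * k) (n∣m*n y) ⟨
    x * pred w * k + y * w        ≡⟨ cong (x * pred w * k +_) eq ⟨
    x * pred w * k + (d + x * k)  ≡⟨ regroup d x (pred w) k ⟩
    d + suc (pred w) * (x * k)    ≡⟨ cong (λ v → d + v * (x * k)) (suc-pred w) ⟩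
    d + w * (x * k)               ≈⟨ +-multipleʳ d (m∣m*n (x * k)) ⟩
    d                             ∎)
  where
    open Congruence w; open ≈-Reasoning
    d : ℕ
    d = gcd k w
    regroup : ∀ d x p k → x * p * k + (d + x * k) ≡ d + suc p * (x * k)
    regroup = solve-∀

bezout : ∀ k w .{{_ : NonZero w}} → ∃ λ u → NonZero u × u * k ≋ gcd k w [mod w ]
bezout k w with bezout-multiple k w
... | u , uk≈d = u + w , +-nonZeroʳ u w , (begin
    (u + w) * k     ≡⟨ *-distribʳ-+ k u w ⟩
    u * k + w * k   ≈⟨ +-multipleʳ (u * k) (m∣m*n k) ⟩
    u * k           ≈⟨ uk≈d ⟩
    gcd k w         ∎)
  where open Congruence w; open ≈-Reasoning

-- Idempotent decomposition of exponents for coprime P, Q: numbers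
-- e₁ = u₁·Q ≡ 1 (mod P) and e₂ = u₂·P ≡ 1 (mod Q), so e₁ + e₂ ≡ 1 (mod P·Q).
record CoprimeBasis (P Q : ℕ) .{{_ : NonZero P}} .{{_ : NonZero Q}} : Set where
  field
    u₁ u₂       : ℕ
    u₁-positive : NonZero u₁
    u₂-positive : NonZero u₂
    e₁≈1        : u₁ * Q ≋ 1 [mod P ]
    e₂≈1        : u₂ * P ≋ 1 [mod Q ]

coprime-basis : ∀ {P Q} .{{_ : NonZero P}} .{{_ : NonZero Q}} → Coprime P Q → CoprimeBasis P Q
coprime-basis {P} {Q} cop = record
  { u₁ = proj₁ b₁ ; u₂ = proj₁ b₂ ; u₁-positive = proj₁ (proj₂ b₁) ; u₂-positive = proj₁ (proj₂ b₂)
  ; e₁≈1 = trans (proj₂ (proj₂ b₁)) (cong (_% P) (coprime⇒gcd≡1 (coprime-sym cop)))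
  ; e₂≈1 = trans (proj₂ (proj₂ b₂)) (cong (_% Q) (coprime⇒gcd≡1 cop)) }
  where
    b₁ : ∃ λ u → NonZero u × u * Q ≋ gcd Q P [mod P ]
    b₁ = bezout Q P
    b₂ : ∃ λ u → NonZero u × u * P ≋ gcd P Q [mod Q ]
    b₂ = bezout P Q

combine-≈ : ∀ P .{{_ : NonZero P}} {e} x y z → e ≋ 1 [mod P ] → x * e + y * (z * P) ≋ x [mod P ]
combine-≈ P {e} x y z e≈1 = begin
  x * e + y * (z * P)  ≈⟨ +-multipleʳ (x * e) (∣n⇒∣m*n y (n∣m*n z)) ⟩
  x * e                ≈⟨ *-cong {x} refl e≈1 ⟩
  x * 1                ≡⟨ *-identityʳ x ⟩
  x                    ∎
  where open Congruence P; open ≈-Reasoning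

module _ {P Q : ℕ} .{{_ : NonZero P}} .{{_ : NonZero Q}} where
  private instance
    P*Q≢0 : NonZero (P * Q)
    P*Q≢0 = m*n≢0 P Q

  crt : ∀ {x y} → Coprime P Q → x ≋ y [mod P ] → x ≋ y [mod Q ] → x ≋ y [mod P * Q ]
  crt cop x≈y[P] x≈y[Q] = Congruence.∣∣-∣⇒≈ (P * Q)
    (coprime-∣-product cop (Congruence.≈⇒∣∣-∣ P x≈y[P]) (Congruence.≈⇒∣∣-∣ Q x≈y[Q]))

  module _ (basis : CoprimeBasis P Q) where
    open CoprimeBasis basis

    basis-combineᴾ : ∀ x y → x * (u₁ * Q) + y * (u₂ * P) ≋ x [mod P ]
    basis-combineᴾ x y = combine-≈ P x y u₂ e₁≈1

    basis-combineᴼ : ∀ x y → x * (u₁ * Q) + y * (u₂ * P) ≋ y [mod Q ]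
    basis-combineᴼ x y = trans (cong (_% Q) (+-comm (x * (u₁ * Q)) (y * (u₂ * P)))) (combine-≈ Q y x u₁ e₂≈1)

    basis-sum : Coprime P Q → u₁ * Q + u₂ * P ≋ 1 [mod P * Q ]
    basis-sum cop = crt cop (subst (_≋ 1 [mod P ]) (ones (u₁ * Q) (u₂ * P)) (basis-combineᴾ 1 1))
                            (subst (_≋ 1 [mod Q ]) (ones (u₁ * Q) (u₂ * P)) (basis-combineᴼ 1 1))
      where
        ones : ∀ a b → 1 * a + 1 * b ≡ a + b
        ones = solve-∀

record Splitting (r ω : ℕ) : Set where
  field
    P β Q   : ℕ
    P∣r     : P ∣ r
    β∣P     : β ∣ P
    β<P     : β < P
    ω≡βQ    : ω ≡ β * Q
    coprime : Coprime P Q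

splitting-∣ : ∀ {r′ r ω} → r′ ∣ r → Splitting r′ ω → Splitting r ω
splitting-∣ r′∣r s = record
  { P = P ; β = β ; Q = Q ; P∣r = ∣-trans P∣r r′∣r ; β∣P = β∣P ; β<P = β<P
  ; ω≡βQ = ω≡βQ ; coprime = coprime }
  where open Splitting s

-- With g = gcd(r, ω) and Q = ω / g, either gcd(r, Q) = 1 and (r, g, Q) is a
-- splitting, or r can be divided by c = gcd(r, Q) > 1 keeping r ∤ ω, and we recurse.
splitting : ∀ ω .{{_ : NonZero ω}} r .{{_ : NonZero r}} → ¬ r ∣ ω → Splitting r ω
splitting ω = <-rec (λ r → .{{_ : NonZero r}} → ¬ r ∣ ω → Splitting r ω) step
  where
  step : ∀ r → (∀ {r′} → r′ < r → .{{_ : NonZero r′}} → ¬ r′ ∣ ω → Splitting r′ ω) →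
         .{{_ : NonZero r}} → ¬ r ∣ ω → Splitting r ω
  step r recurse r∤ω = split (coprime? r Q₀)
    where
    g : ℕ
    g = gcd r ω
    instance g≢0 : NonZero g
             g≢0 = ≢-nonZero (gcd[m,n]≢0 r ω (inj₁ (≢-nonZero⁻¹ r)))
    Q₀ : ℕ
    Q₀ = ω / g

    split : Dec (Coprime r Q₀) → Splitting r ω
    split (yes cop) = record
      { P = r ; β = g ; Q = Q₀ ; P∣r = ∣-refl ; β∣P = gcd[m,n]∣m r ω
      ; β<P = ≤∧≢⇒< (∣⇒≤ (gcd[m,n]∣m r ω)) (λ g≡r → r∤ω (subst (_∣ ω) g≡r (gcd[m,n]∣n r ω)))
      ; ω≡βQ = sym (m*[n/m]≡n (gcd[m,n]∣n r ω)) ; coprime = cop }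
    split (no ¬cop) = splitting-∣ (quotient-∣ c∣r) (recurse (quotient-< c∣r) r′∤ω)
      where
      c : ℕ
      c = gcd r Q₀
      c∣r : c ∣ r
      c∣r = gcd[m,n]∣m r Q₀
      instance c>1 : NonTrivial c
               c>1 = n>1⇒nonTrivial (≤∧≢⇒< (>-nonZero⁻¹ c {{≢-nonZero (gcd[m,n]≢0 r Q₀ (inj₁ (≢-nonZero⁻¹ r)))}})
                                            (λ 1≡c → ¬cop (gcd≡1⇒coprime (sym 1≡c))))
      r′ : ℕ
      r′ = quotient c∣r
      instance r′≢0 : NonZero r′
               r′≢0 = quotient≢0 c∣r
      -- if r′ ∣ ω then r′ ∣ g, so r = r′·c divides g·Q₀ = ω
      r′∤ω : ¬ r′ ∣ ω
      r′∤ω r′∣ω = r∤ω (subst₂ _∣_ (sym (m∣n⇒n≡quotient*m c∣r)) (m*[n/m]≡n (gcd[m,n]∣n r ω))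
                       (*-pres-∣ (gcd-greatest (quotient-∣ c∣r) r′∣ω) (gcd[m,n]∣n r Q₀)))

record Least (P : ℕ → Set) (o : ℕ) : Set where
  field
    {{positive}} : NonZero o
    holds : P o
    below : ∀ j → .{{_ : NonZero j}} → j < o → ¬ P j

least-or-none : ∀ {P} → Decidable P → ∀ n → ∃ (Least P) ⊎ (∀ j → .{{_ : NonZero j}} → j ≤ n → ¬ P j)
least-or-none P? zero = inj₂ λ j j≤0 → contradiction (≤-antisym j≤0 z≤n) (≢-nonZero⁻¹ j)
least-or-none P? (suc n) with least-or-none P? n | P? (suc n)
... | inj₁ found | _      = inj₁ found
... | inj₂ none  | yes Pn = inj₁ (suc n , record { holds = Pn ; below = λ j j<1+n → none j (≤-pred j<1+n) })
... | inj₂ none  | no ¬Pn = inj₂ λ j j≤1+n →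
  [ (λ j<1+n → none j (≤-pred j<1+n)) , (λ { refl → ¬Pn }) ]′ (m≤n⇒m<n∨m≡n j≤1+n)

least-exists : ∀ {P} → Decidable P → ∀ n .{{_ : NonZero n}} → P n → ∃ (Least P)
least-exists P? n Pn = [ (λ found → found) , (λ none → contradiction Pn (none n ≤-refl)) ]′ (least-or-none P? n)

least-unique : ∀ {P o₁ o₂} → Least P o₁ → Least P o₂ → o₁ ≡ o₂
least-unique l₁ l₂ =
  ≤-antisym (≮⇒≥ λ o₂<o₁ → Least.below l₁ _ {{Least.positive l₂}} o₂<o₁ (Least.holds l₂))
            (≮⇒≥ λ o₁<o₂ → Least.below l₂ _ {{Least.positive l₁}} o₁<o₂ (Least.holds l₁))

*-^ : ∀ x y i → (x * y) ^ i ≡ x ^ i * y ^ i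
*-^ x y zero    = refl
*-^ x y (suc i) = begin
  x * y * (x * y) ^ i      ≡⟨ cong (x * y *_) (*-^ x y i) ⟩
  x * y * (x ^ i * y ^ i)  ≡⟨ *-*-comm x y (x ^ i) (y ^ i) ⟩
  x * x ^ i * (y * y ^ i)  ∎
  where
    open ≡-Reasoning
    *-*-comm : ∀ a b c d → a * b * (c * d) ≡ a * c * (b * d)
    *-*-comm = solve-∀

module Residues (m : ℕ) .{{_ : NonZero m}} where

  open Congruence m public
  open ≈-Reasoning

  Idem : ℕ → Set
  Idem e = e * e ≈ e

  Idem? : Decidable Idem
  Idem? e = (e * e) % m ≟ e % m

  Idem-resp : ∀ {e e′} → e ≈ e′ → Idem e → Idem e′
  Idem-resp {e} {e′} e≈e′ idem = begin
    e′ * e′  ≈⟨ *-cong e≈e′ e≈e′ ⟨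
    e * e    ≈⟨ idem ⟩
    e        ≈⟨ e≈e′ ⟩
    e′       ∎

  idem-^ : ∀ {e} → Idem e → ∀ s .{{_ : NonZero s}} → e ^ s ≈ e
  idem-^ {e} idem 1             = cong (_% m) (*-identityʳ e)
  idem-^ {e} idem (suc (suc s)) = begin
    e * e ^ suc s  ≈⟨ *-cong {e} refl (idem-^ idem (suc s)) ⟩
    e * e          ≈⟨ idem ⟩
    e              ∎

  ^-*-cong : ∀ x c y d w → x ^ c ≈ y ^ d → x ^ (c * w) ≈ y ^ (d * w)
  ^-*-cong x c y d w xᶜ≈yᵈ = begin
    x ^ (c * w)   ≡⟨ ^-*-assoc x c w ⟨
    (x ^ c) ^ w   ≈⟨ ^-cong xᶜ≈yᵈ w ⟩
    (y ^ d) ^ w   ≡⟨ ^-*-assoc y d w ⟩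
    y ^ (d * w)   ∎

  record Periodic (c T : ℕ) : Set where
    constructor periodic
    field period : c ^ suc T ≈ c

  periodic-resp : ∀ {c c′ T} → c ≈ c′ → Periodic c T → Periodic c′ T
  periodic-resp {c} {c′} {T} c≈c′ (periodic per) = periodic (begin
    c′ ^ suc T  ≈⟨ ^-cong c≈c′ (suc T) ⟨
    c ^ suc T   ≈⟨ per ⟩
    c           ≈⟨ c≈c′ ⟩
    c′          ∎)

  periodic-shift : ∀ {c T} → Periodic c T → ∀ X .{{_ : NonZero X}} s → c ^ (X + T * s) ≈ c ^ X
  periodic-shift {c} {T} per X zero = cong (λ e → c ^ e % m) (trans (cong (X +_) (*-zeroʳ T)) (+-identityʳ X))
  periodic-shift {c} {T} per (suc X) (suc s) = begin
    c ^ (suc X + T * suc s)      ≡⟨ cong (c ^_) (regroup X T s) ⟩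
    c ^ (X + T * s + suc T)      ≡⟨ ^-distribˡ-+-* c (X + T * s) (suc T) ⟩
    c ^ (X + T * s) * c ^ suc T  ≈⟨ *-cong {c ^ (X + T * s)} refl (Periodic.period per) ⟩
    c ^ (X + T * s) * c          ≡⟨ *-comm (c ^ (X + T * s)) c ⟩
    c ^ suc (X + T * s)          ≈⟨ periodic-shift per (suc X) s ⟩
    c ^ suc X                    ∎
    where
      regroup : ∀ X T s → suc X + T * suc s ≡ X + T * s + suc T
      regroup = solve-∀

  periodic-cong : ∀ {c T} → Periodic c T → .{{_ : NonZero T}} →
                  ∀ {X Y} .{{_ : NonZero X}} .{{_ : NonZero Y}} → X ≋ Y [mod T ] → c ^ X ≈ c ^ Y
  periodic-cong {c} {T} per {X} {Y} X≈Y = begin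
    c ^ X                  ≈⟨ periodic-shift per X (Y / T) ⟨
    c ^ (X + T * (Y / T))  ≡⟨ cong (c ^_) (Congruence.≈⇒offsets T X≈Y) ⟩
    c ^ (Y + T * (X / T))  ≈⟨ periodic-shift per Y (X / T) ⟩
    c ^ Y                  ∎

  periodic-multiples : ∀ {c T i j} → Periodic c T → T ∣ i → T ∣ j →
                       .{{_ : NonZero i}} .{{_ : NonZero j}} → c ^ i ≈ c ^ j
  periodic-multiples {c} {T} {i} {j} per (divides qᵢ refl) (divides qⱼ refl) = begin
    c ^ i            ≈⟨ periodic-shift per i qⱼ ⟨
    c ^ (i + T * qⱼ) ≡⟨ cong (c ^_) (swap qᵢ qⱼ T) ⟩
    c ^ (j + T * qᵢ) ≈⟨ periodic-shift per j qᵢ ⟩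
    c ^ j            ∎
    where
      swap : ∀ a b T → a * T + T * b ≡ b * T + T * a
      swap = solve-∀

  periodic-idem : ∀ {c T j} → Periodic c T → T ∣ j → .{{_ : NonZero j}} → Idem (c ^ j)
  periodic-idem {c} {T} {j} per T∣j = begin
    c ^ j * c ^ j  ≡⟨ ^-distribˡ-+-* c j j ⟨
    c ^ (j + j)    ≈⟨ periodic-multiples per (∣m∣n⇒∣m+n T∣j T∣j) T∣j {{+-nonZeroˡ j j}} ⟩
    c ^ j          ∎

  periodic-∣ : ∀ {c T T′} → Periodic c T → T ∣ T′ → Periodic c T′
  periodic-∣ {c} {T} per (divides q refl) = periodic (begin
    c ^ suc (q * T)    ≡⟨ cong (λ e → c ^ suc e) (*-comm q T) ⟩
    c ^ (1 + T * q)    ≈⟨ periodic-shift per 1 q ⟩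
    c ^ 1              ≡⟨ *-identityʳ c ⟩
    c                  ∎)

  periodic-^ : ∀ {c T} → Periodic c T → ∀ n .{{_ : NonZero n}} → Periodic (c ^ n) T
  periodic-^ {c} {T} per n = periodic (begin
    (c ^ n) ^ suc T    ≡⟨ ^-*-assoc c n (suc T) ⟩
    c ^ (n * suc T)    ≡⟨ cong (c ^_) (regroup n T) ⟩
    c ^ (n + T * n)    ≈⟨ periodic-shift per n n ⟩
    c ^ n              ∎)
    where
      regroup : ∀ n T → n * suc T ≡ n + T * n
      regroup = solve-∀

  periodic-* : ∀ {u v T} → Periodic u T → Periodic v T → Periodic (u * v) T
  periodic-* {u} {v} {T} (periodic perᵤ) (periodic perᵥ) = periodic (begin
    (u * v) ^ suc T        ≡⟨ *-^ u v (suc T) ⟩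
    u ^ suc T * v ^ suc T  ≈⟨ *-cong perᵤ perᵥ ⟩
    u * v                  ∎)

  HasOrder : ℕ → ℕ → Set
  HasOrder c = Least (λ j → Idem (c ^ j))

  record Regular (c o : ℕ) : Set where
    field
      hasOrder : HasOrder c o
      isPeriodic : Periodic c o
    open Least hasOrder public

  order-exists : ∀ {c T} → Periodic c T → .{{_ : NonZero T}} → ∃ (Regular c)
  order-exists {c} {T} per with least-exists (λ j → Idem? (c ^ j)) T (periodic-idem per ∣-refl)
  ... | o , ord = o , record { hasOrder = ord ; isPeriodic = periodic (begin
      c ^ suc o    ≈⟨ *-cong {c} refl cᵒ≈cᵀ ⟩
      c ^ suc T    ≈⟨ Periodic.period per ⟩
      c            ∎) }
    where
      open Least ord
      -- both c^o and c^T are idempotent, and each is a power of the other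
      cᵒ≈cᵀ : c ^ o ≈ c ^ T
      cᵒ≈cᵀ = begin
        c ^ o         ≈⟨ idem-^ holds T ⟨
        (c ^ o) ^ T   ≡⟨ ^-*-assoc c o T ⟩
        c ^ (o * T)   ≡⟨ cong (c ^_) (*-comm o T) ⟩
        c ^ (T * o)   ≡⟨ ^-*-assoc c T o ⟨
        (c ^ T) ^ o   ≈⟨ idem-^ (periodic-idem per ∣-refl) o ⟩
        c ^ T         ∎

  order-∣ : ∀ {c o j} → Regular c o → .{{_ : NonZero j}} → Idem (c ^ j) → o ∣ j
  order-∣ {c} {o} {j} reg idem with j % o in j%o
  ... | zero  = m%n≡0⇒n∣m j o j%o
  ... | suc ρ = contradiction (Idem-resp cʲ≈cᵖ idem) (below (suc ρ) ρ<o)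
    where
      open Regular reg
      ρ<o : suc ρ < o
      ρ<o = subst (_< o) j%o (m%n<n j o)
      cʲ≈cᵖ : c ^ j ≈ c ^ suc ρ
      cʲ≈cᵖ = periodic-cong isPeriodic (trans (sym (m%n%n≡m%n j o)) (cong (_% o) j%o))

  power-regular : ∀ {c P} α .{{_ : NonZero α}} → Regular c (α * P) → Regular (c ^ α) P
  power-regular {c} {P} α reg = record
    { hasOrder = record
      { positive = m*n≢0⇒n≢0 α
      ; holds = subst Idem (sym (^-*-assoc c α P)) holds
      ; below = λ j j<P idem → <⇒≱ j<P (∣⇒≤ (*-cancelˡ-∣ α
                  (order-∣ reg {{m*n≢0 α j}} (subst Idem (^-*-assoc c α j) idem)))) }
    ; isPeriodic = periodic (begin
        (c ^ α) ^ suc P      ≡⟨ ^-*-assoc c α (suc P) ⟩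
        c ^ (α * suc P)      ≡⟨ cong (c ^_) (regroup α P) ⟩
        c ^ (α + α * P * 1)  ≈⟨ periodic-shift isPeriodic α 1 ⟩
        c ^ α                ∎) }
    where
      open Regular reg
      regroup : ∀ α P → α * suc P ≡ α + α * P * 1
      regroup = solve-∀

  order-∣-power : ∀ {u v r s k n} → Regular u r → Periodic v s →
                  .{{_ : NonZero k}} .{{_ : NonZero n}} .{{_ : NonZero s}} →
                  u ^ k ≈ v ^ n → r ∣ k * s
  order-∣-power {u} {v} {r} {s} {k} {n} reg per uᵏ≈vⁿ =
    order-∣ reg (Idem-resp (^-*-cong v n u k s (sym uᵏ≈vⁿ)) (periodic-idem per (n∣m*n n)))
    where
      instance
        ns≢0 : NonZero (n * s)
        ns≢0 = m*n≢0 n s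
        ks≢0 : NonZero (k * s)
        ks≢0 = m*n≢0 k s

  shared-idempotent : ∀ {u v r s k n} → Regular u r → Regular v s →
                      .{{_ : NonZero k}} .{{_ : NonZero n}} → u ^ k ≈ v ^ n → u ^ r ≈ v ^ s
  shared-idempotent {u} {v} {r} {s} {k} {n} regᵤ regᵥ uᵏ≈vⁿ = begin
    u ^ r         ≈⟨ periodic-multiples (Regular.isPeriodic regᵤ) ∣-refl (n∣m*n k) ⟩
    u ^ (k * r)   ≈⟨ ^-*-cong u k v n r uᵏ≈vⁿ ⟩
    v ^ (n * r)   ≈⟨ periodic-multiples (Regular.isPeriodic regᵥ) s∣nr ∣-refl ⟩
    v ^ s         ∎
    where
      instance
        r≢0 : NonZero r
        r≢0 = Regular.positive regᵤ
        s≢0 : NonZero s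
        s≢0 = Regular.positive regᵥ
        kr≢0 : NonZero (k * r)
        kr≢0 = m*n≢0 k r
        nr≢0 : NonZero (n * r)
        nr≢0 = m*n≢0 n r
      s∣nr : s ∣ n * r
      s∣nr = order-∣-power regᵥ (Regular.isPeriodic regᵤ) (sym uᵏ≈vⁿ)

  -- Let u, v be regular of coprime orders P, Q with the same idempotent.
  -- Then P divides the order o of u·v: (uv)^(oQ) is idempotent and equals u^(oQ),
  -- because v^(oQ) is the common idempotent, which u^(oQ) absorbs.
  product-order-∣ˡ : ∀ {u v P Q o} → Regular u P → Regular v Q → u ^ P ≈ v ^ Q →
                     Coprime P Q → Regular (u * v) o → P ∣ o
  product-order-∣ˡ {u} {v} {P} {Q} {o} regᵤ regᵥ uᴾ≈vᴼ cop regᵤᵥ =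
    coprime-divisor cop (subst (P ∣_) (*-comm o Q) (order-∣ regᵤ (Idem-resp uvᵒᴼ≈uᵒᴼ idem)))
    where
      instance
        P≢0 : NonZero P
        P≢0 = Regular.positive regᵤ
        Q≢0 : NonZero Q
        Q≢0 = Regular.positive regᵥ
        o≢0 : NonZero o
        o≢0 = Regular.positive regᵤᵥ
        oQ≢0 : NonZero (o * Q)
        oQ≢0 = m*n≢0 o Q
      idem : Idem ((u * v) ^ (o * Q))
      idem = periodic-idem (Regular.isPeriodic regᵤᵥ) (m∣m*n Q)
      uvᵒᴼ≈uᵒᴼ : (u * v) ^ (o * Q) ≈ u ^ (o * Q)
      uvᵒᴼ≈uᵒᴼ = begin
        (u * v) ^ (o * Q)          ≡⟨ *-^ u v (o * Q) ⟩
        u ^ (o * Q) * v ^ (o * Q)  ≈⟨ *-cong {u ^ (o * Q)} refl (periodic-multiples (Regular.isPeriodic regᵥ) (n∣m*n o) ∣-refl) ⟩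
        u ^ (o * Q) * v ^ Q        ≈⟨ *-cong {u ^ (o * Q)} refl uᴾ≈vᴼ ⟨
        u ^ (o * Q) * u ^ P        ≡⟨ ^-distribˡ-+-* u (o * Q) P ⟨
        u ^ (o * Q + P)            ≡⟨ cong (λ e → u ^ (o * Q + e)) (*-identityʳ P) ⟨
        u ^ (o * Q + P * 1)        ≈⟨ periodic-shift (Regular.isPeriodic regᵤ) (o * Q) 1 ⟩
        u ^ (o * Q)                ∎

  product-order : ∀ {u v P Q o} → Regular u P → Regular v Q → u ^ P ≈ v ^ Q →
                  Coprime P Q → Regular (u * v) o → P * Q ∣ o
  product-order {u} {v} {o = o} regᵤ regᵥ uᴾ≈vᴼ cop regᵤᵥ = coprime-∣-product cop
    (product-order-∣ˡ regᵤ regᵥ uᴾ≈vᴼ cop regᵤᵥ)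
    (product-order-∣ˡ regᵥ regᵤ (sym uᴾ≈vᴼ) (coprime-sym cop) (subst (λ z → Regular z o) (*-comm u v) regᵤᵥ))

  -- Let u, v have coprime periods P, Q and let a have period P·Q, with a^Q a
  -- positive power u^A and a^P a positive power v^B.  Then a is a positive power
  -- of u·v: split a = a^e₁·a^e₂ along a coprime basis and choose the exponent
  -- t ≡ A·u₁ (mod P), t ≡ B·u₂ (mod Q).
  product-reaches : ∀ {u v a P Q A B} .{{_ : NonZero P}} .{{_ : NonZero Q}} →
                    Periodic u P → Periodic v Q → Coprime P Q → Periodic a (P * Q) →
                    .{{_ : NonZero A}} .{{_ : NonZero B}} → a ^ Q ≈ u ^ A → a ^ P ≈ v ^ B →
                    ∃ λ t → NonZero t × (u * v) ^ t ≈ a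
  product-reaches {u} {v} {a} {P} {Q} {A} {B} perᵤ perᵥ cop perₐ aᴼ≈uᴬ aᴾ≈vᴮ =
    t , t≢0 , (begin
      (u * v) ^ t              ≡⟨ *-^ u v t ⟩
      u ^ t * v ^ t            ≈⟨ *-cong uᵗ≈aᵉ¹ vᵗ≈aᵉ² ⟩
      a ^ e₁ * a ^ e₂          ≡⟨ ^-distribˡ-+-* a e₁ e₂ ⟨
      a ^ (e₁ + e₂)            ≈⟨ periodic-cong perₐ {{_}} {{+-nonZeroˡ e₁ e₂}} (basis-sum basis cop) ⟩
      a ^ 1                    ≡⟨ *-identityʳ a ⟩
      a                        ∎)
    where
      basis : CoprimeBasis P Q
      basis = coprime-basis cop
      open CoprimeBasis basis
      e₁ e₂ t : ℕ
      e₁ = u₁ * Q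
      e₂ = u₂ * P
      t = A * u₁ * e₁ + B * u₂ * e₂
      instance
        PQ≢0 : NonZero (P * Q)
        PQ≢0 = m*n≢0 P Q
        u₁≢0 : NonZero u₁
        u₁≢0 = u₁-positive
        u₂≢0 : NonZero u₂
        u₂≢0 = u₂-positive
        e₁≢0 : NonZero e₁
        e₁≢0 = m*n≢0 u₁ Q
        Au₁≢0 : NonZero (A * u₁)
        Au₁≢0 = m*n≢0 A u₁
        Bu₂≢0 : NonZero (B * u₂)
        Bu₂≢0 = m*n≢0 B u₂
        Au₁e₁≢0 : NonZero (A * u₁ * e₁)
        Au₁e₁≢0 = m*n≢0 (A * u₁) e₁
        t≢0 : NonZero t
        t≢0 = +-nonZeroˡ (A * u₁ * e₁) (B * u₂ * e₂)
      uᵗ≈aᵉ¹ : u ^ t ≈ a ^ e₁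
      uᵗ≈aᵉ¹ = begin
        u ^ t          ≈⟨ periodic-cong perᵤ (basis-combineᴾ basis (A * u₁) (B * u₂)) ⟩
        u ^ (A * u₁)   ≈⟨ ^-*-cong a Q u A u₁ aᴼ≈uᴬ ⟨
        a ^ (Q * u₁)   ≡⟨ cong (a ^_) (*-comm Q u₁) ⟩
        a ^ e₁         ∎
      vᵗ≈aᵉ² : v ^ t ≈ a ^ e₂
      vᵗ≈aᵉ² = begin
        v ^ t          ≈⟨ periodic-cong perᵥ (basis-combineᴼ basis (A * u₁) (B * u₂)) ⟩
        v ^ (B * u₂)   ≈⟨ ^-*-cong a P v B u₂ aᴾ≈vᴮ ⟨
        a ^ (P * u₂)   ≡⟨ cong (a ^_) (*-comm P u₂) ⟩
        a ^ e₂         ∎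

  root-power : ∀ y k a Q α γ → y ^ k ≈ a → k * Q ≡ α * γ → a ^ Q ≈ (y ^ α) ^ γ
  root-power y k a Q α γ yᵏ≈a kQ≡αγ = begin
    a ^ Q         ≈⟨ ^-cong yᵏ≈a Q ⟨
    (y ^ k) ^ Q   ≡⟨ ^-*-assoc y k Q ⟩
    y ^ (k * Q)   ≡⟨ cong (y ^_) kQ≡αγ ⟩
    y ^ (α * γ)   ≡⟨ ^-*-assoc y α γ ⟨
    (y ^ α) ^ γ   ∎

  Maximal : ℕ → ℕ → Set
  Maximal a ω = ∀ {c o} → Regular c o → (∃ λ t → NonZero t × c ^ t ≈ a) → o ≤ ω

  -- Let y, b be regular of orders α·P and β·Q with
  -- y^k ≈ a ≈ b^n, β ∣ P and P, Q coprime.  Then u = y^α and v = b^β are regular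
  -- of the coprime orders P and Q with a common idempotent, so the order of u·v
  -- is a multiple of P·Q; and a is a power of u·v.
  module Combination {a y b α β P Q k n} (regᵧ : Regular y (α * P)) (regᵦ : Regular b (β * Q))
                     .{{_ : NonZero k}} .{{_ : NonZero n}} (yᵏ≈a : y ^ k ≈ a) (bⁿ≈a : b ^ n ≈ a)
                     (β∣P : β ∣ P) (cop : Coprime P Q) where

    private instance
      αP≢0 : NonZero (α * P)
      αP≢0 = Regular.positive regᵧ
      βQ≢0 : NonZero (β * Q)
      βQ≢0 = Regular.positive regᵦ
      α≢0 : NonZero α
      α≢0 = m*n≢0⇒m≢0 α
      β≢0 : NonZero β
      β≢0 = m*n≢0⇒m≢0 β
      P≢0 : NonZero P
      P≢0 = m*n≢0⇒n≢0 α
      Q≢0 : NonZero Q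
      Q≢0 = m*n≢0⇒n≢0 β
      PQ≢0 : NonZero (P * Q)
      PQ≢0 = m*n≢0 P Q
      kQ≢0 : NonZero (k * Q)
      kQ≢0 = m*n≢0 k Q

    regᵤ : Regular (y ^ α) P
    regᵤ = power-regular α regᵧ

    regᵥ : Regular (b ^ β) Q
    regᵥ = power-regular β regᵦ

    shared : (y ^ α) ^ P ≈ (b ^ β) ^ Q
    shared = subst₂ _≈_ (sym (^-*-assoc y α P)) (sym (^-*-assoc b β Q))
               (shared-idempotent regᵧ regᵦ (trans yᵏ≈a (sym bⁿ≈a)))

    -- P·Q is a common period of y^α and b^β, so their product has an order
    orderᵤᵥ : ∃ (Regular (y ^ α * b ^ β))
    orderᵤᵥ = order-exists (periodic-* (periodic-∣ (Regular.isPeriodic regᵤ) (m∣m*n Q))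
                                       (periodic-∣ (Regular.isPeriodic regᵥ) (n∣m*n P)))

    order-bound : P * Q ≤ proj₁ orderᵤᵥ
    order-bound = ∣⇒≤ {{Regular.positive (proj₂ orderᵤᵥ)}} (product-order regᵤ regᵥ shared cop (proj₂ orderᵤᵥ))

    δ : ℕ
    δ = quotient β∣P

    P≡δβ : P ≡ δ * β
    P≡δβ = m∣n⇒n≡quotient*m β∣P

    -- the order α·δ·β of y divides k·(β·Q), hence α ∣ k·Q
    α∣kQ : α ∣ k * Q
    α∣kQ = m*n∣⇒m∣ α δ (*-cancelʳ-∣ β (subst₂ _∣_
             (trans (cong (α *_) P≡δβ) (sym (*-assoc α δ β)))
             (regroup k β Q)
             (order-∣-power regᵧ (Regular.isPeriodic regᵦ) (trans yᵏ≈a (sym bⁿ≈a)))))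
      where
        regroup : ∀ k β Q → k * (β * Q) ≡ k * Q * β
        regroup = solve-∀

    γ : ℕ
    γ = quotient α∣kQ

    aᴼ≈uᵞ : a ^ Q ≈ (y ^ α) ^ γ
    aᴼ≈uᵞ = root-power y k a Q α γ yᵏ≈a (trans (m∣n⇒n≡quotient*m α∣kQ) (*-comm γ α))

    aᴾ≈vⁿᵟ : a ^ P ≈ (b ^ β) ^ (n * δ)
    aᴾ≈vⁿᵟ = root-power b n a P β (n * δ) bⁿ≈a (trans (cong (n *_) P≡δβ) (regroup n δ β))
      where
        regroup : ∀ n δ β → n * (δ * β) ≡ β * (n * δ)
        regroup = solve-∀

    -- b has period β·Q, which divides P·Q
    periodicₐ : Periodic a (P * Q)
    periodicₐ = periodic-resp bⁿ≈a (periodic-∣ (periodic-^ (Regular.isPeriodic regᵦ) n) (*-monoˡ-∣ Q β∣P))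

    reaches : ∃ λ t → NonZero t × (y ^ α * b ^ β) ^ t ≈ a
    reaches = product-reaches {A = γ} {B = n * δ} (Regular.isPeriodic regᵤ) (Regular.isPeriodic regᵥ) cop periodicₐ
                {{quotient≢0 α∣kQ}} {{m*n≢0 n δ {{it}} {{quotient≢0 β∣P}}}} aᴼ≈uᵞ aᴾ≈vⁿᵟ

    bound : ∀ {ω} → Maximal a ω → P * Q ≤ ω
    bound max = ≤-trans order-bound (max (proj₂ orderᵤᵥ) reaches)

  -- Key lemma: if b is regular of order ω, b^n ≈ a and ω is maximal for a, then
  -- the order r of every regular k-th root of a divides ω.  Otherwise a coprime
  -- splitting of r against ω = β·Q gives P·Q ≤ ω < P·Q by the combination step.
  root-order-∣ : ∀ {a b ω n y r k} → Maximal a ω → Regular b ω → .{{_ : NonZero n}} → b ^ n ≈ a →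
                 Regular y r → .{{_ : NonZero k}} → y ^ k ≈ a → r ∣ ω
  root-order-∣ {a} {b} {ω} {n} {y} {r} max regᵦ bⁿ≈a regᵧ yᵏ≈a with r ∣? ω
  ... | yes r∣ω = r∣ω
  ... | no r∤ω = contradiction (Combination.bound {α = quotient P∣r} regᵧ′ regᵦ′ yᵏ≈a bⁿ≈a β∣P coprime max)
                               (<⇒≱ ω<PQ)
    where
      instance
        ω≢0 : NonZero ω
        ω≢0 = Regular.positive regᵦ
        r≢0 : NonZero r
        r≢0 = Regular.positive regᵧ
      open Splitting (splitting ω r r∤ω)
      instance
        Q≢0 : NonZero Q
        Q≢0 = m*n≢0⇒n≢0 β {{subst NonZero ω≡βQ ω≢0}}
      regᵧ′ : Regular y (quotient P∣r * P)
      regᵧ′ = subst (Regular y) (m∣n⇒n≡quotient*m P∣r) regᵧ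
      regᵦ′ : Regular b (β * Q)
      regᵦ′ = subst (Regular b) ω≡βQ regᵦ
      ω<PQ : ω < P * Q
      ω<PQ = subst (_< P * Q) (sym ω≡βQ) (*-monoˡ-< Q β<P)

  eventually-periodic : ∀ {c k T} → Periodic (c ^ k) T → ∀ X s → k ≤ X → c ^ (X + k * T * s) ≈ c ^ X
  eventually-periodic {c} {k} {T} per X s k≤X = begin
    c ^ (X + k * T * s)                ≡⟨ cong (λ e → c ^ (e + k * T * s)) (m∸n+n≡m k≤X) ⟨
    c ^ (X ∸ k + k + k * T * s)        ≡⟨ cong (c ^_) (regroup (X ∸ k) k T s) ⟩
    c ^ (X ∸ k + k * (1 + T * s))      ≡⟨ ^-distribˡ-+-* c (X ∸ k) (k * (1 + T * s)) ⟩
    c ^ (X ∸ k) * c ^ (k * (1 + T * s))  ≡⟨ cong (c ^ (X ∸ k) *_) (^-*-assoc c k (1 + T * s)) ⟨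
    c ^ (X ∸ k) * (c ^ k) ^ (1 + T * s)  ≈⟨ *-cong {c ^ (X ∸ k)} refl (periodic-shift per 1 s) ⟩
    c ^ (X ∸ k) * ((c ^ k) * 1)        ≡⟨ cong (c ^ (X ∸ k) *_) (*-identityʳ (c ^ k)) ⟩
    c ^ (X ∸ k) * c ^ k                ≡⟨ ^-distribˡ-+-* c (X ∸ k) k ⟨
    c ^ (X ∸ k + k)                    ≡⟨ cong (c ^_) (m∸n+n≡m k≤X) ⟩
    c ^ X                              ∎
    where
      regroup : ∀ Y k T s → Y + k + k * T * s ≡ Y + k * (1 + T * s)
      regroup = solve-∀

  -- If c^k has period T, then y = c^(1+k·T) has period k·T and y^k ≈ c^k:
  -- a residue whose k-th power is regular can be replaced by a regular one.
  regular-root : ∀ {c k T} .{{_ : NonZero k}} .{{_ : NonZero T}} → Periodic (c ^ k) T →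
                 Periodic (c ^ suc (k * T)) (k * T) × (c ^ suc (k * T)) ^ k ≈ c ^ k
  regular-root {c} {k} {T} per = periodic (begin
      (c ^ suc (k * T)) ^ suc (k * T)          ≡⟨ ^-*-assoc c (suc (k * T)) (suc (k * T)) ⟩
      c ^ (suc (k * T) * suc (k * T))          ≡⟨⟩
      c ^ (suc (k * T) + k * T * suc (k * T))  ≈⟨ eventually-periodic per (suc (k * T)) (suc (k * T)) (m≤n⇒m≤1+n k≤kT) ⟩
      c ^ suc (k * T)                          ∎)
    , (begin
      (c ^ suc (k * T)) ^ k                    ≡⟨ ^-*-assoc c (suc (k * T)) k ⟩
      c ^ (suc (k * T) * k)                    ≡⟨ cong (c ^_) (*-comm (suc (k * T)) k) ⟩
      c ^ (k * suc (k * T))                    ≡⟨ cong (c ^_) (*-suc k (k * T)) ⟩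
      c ^ (k + k * (k * T))                    ≡⟨ cong (λ e → c ^ (k + e)) (*-comm k (k * T)) ⟩
      c ^ (k + k * T * k)                      ≈⟨ eventually-periodic per k k ≤-refl ⟩
      c ^ k                                    ∎)
    where
      k≤kT : k ≤ k * T
      k≤kT = m≤m*n k T

  -- (⇒) If x^k ≈ a, where a has a period, then a^(ω / gcd(k, ω)) is idempotent:
  -- a regular k-th root y of a exists, its order divides ω, and ω ∣ k·ω/gcd(k, ω).
  root⇒idempotent : ∀ {a b ω n T x k} → Maximal a ω → Regular b ω → .{{_ : NonZero n}} → b ^ n ≈ a →
                    Periodic a T → .{{_ : NonZero T}} → .{{_ : NonZero k}} → x ^ k ≈ a →
                    .{{_ : NonZero (gcd k ω)}} → Idem (a ^ (ω / gcd k ω))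
  root⇒idempotent {a} {b} {ω} {n} {T} {x} {k} max regᵦ bⁿ≈a perₐ xᵏ≈a =
    Idem-resp (^-cong (trans yᵏ≈xᵏ xᵏ≈a) E) (subst Idem (sym (^-*-assoc y k E)) idem)
    where
      instance
        ω≢0 : NonZero ω
        ω≢0 = Regular.positive regᵦ
        kT≢0 : NonZero (k * T)
        kT≢0 = m*n≢0 k T
      y : ℕ
      y = x ^ suc (k * T)
      root : Periodic y (k * T) × y ^ k ≈ x ^ k
      root = regular-root (periodic-resp (sym xᵏ≈a) perₐ)
      yᵏ≈xᵏ : y ^ k ≈ x ^ k
      yᵏ≈xᵏ = proj₂ root
      orderᵧ : ∃ (Regular y)
      orderᵧ = order-exists (proj₁ root)
      d∣ω : gcd k ω ∣ ω
      d∣ω = gcd[m,n]∣n k ω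
      E : ℕ
      E = ω / gcd k ω
      ω≡dE : ω ≡ gcd k ω * E
      ω≡dE = sym (m*[n/m]≡n d∣ω)
      instance
        E≢0 : NonZero E
        E≢0 = m*n≢0⇒n≢0 (gcd k ω) {{subst NonZero ω≡dE ω≢0}}
        kE≢0 : NonZero (k * E)
        kE≢0 = m*n≢0 k E
      ω∣kE : ω ∣ k * E
      ω∣kE = subst (_∣ k * E) (sym ω≡dE) (*-monoˡ-∣ E (gcd[m,n]∣m k ω))
      idem : Idem (y ^ (k * E))
      idem = periodic-idem (Regular.isPeriodic (proj₂ orderᵧ))
               (∣-trans (root-order-∣ max regᵦ bⁿ≈a (proj₂ orderᵧ) (trans yᵏ≈xᵏ xᵏ≈a)) ω∣kE)

  -- (⇐) If a^(ω / gcd(k, ω)) is idempotent, then gcd(k, ω) ∣ n and, with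
  -- u·k ≡ gcd(k, ω) (mod ω), the residue b^(u·n / gcd(k, ω)) is a k-th root of a.
  idempotent⇒root : ∀ {a b ω n k} → Regular b ω → .{{_ : NonZero n}} → b ^ n ≈ a →
                    .{{_ : NonZero k}} .{{_ : NonZero (gcd k ω)}} → Idem (a ^ (ω / gcd k ω)) →
                    ∃ λ x → x ^ k ≈ a
  idempotent⇒root {a} {b} {ω} {n} {k} regᵦ bⁿ≈a idem = b ^ (n′ * u) , (begin
      (b ^ (n′ * u)) ^ k  ≡⟨ ^-*-assoc b (n′ * u) k ⟩
      b ^ (n′ * u * k)    ≡⟨ cong (b ^_) (*-assoc n′ u k) ⟩
      b ^ (n′ * (u * k))  ≈⟨ periodic-cong (Regular.isPeriodic regᵦ) (Congruence.*-cong ω {n′} refl uk≈d) ⟩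
      b ^ (n′ * d)        ≡⟨ cong (b ^_) n≡n′d ⟨
      b ^ n               ≈⟨ bⁿ≈a ⟩
      a                   ∎)
    where
      instance
        ω≢0 : NonZero ω
        ω≢0 = Regular.positive regᵦ
      d E : ℕ
      d = gcd k ω
      E = ω / d
      ω≡dE : ω ≡ d * E
      ω≡dE = sym (m*[n/m]≡n (gcd[m,n]∣n k ω))
      instance
        E≢0 : NonZero E
        E≢0 = m*n≢0⇒n≢0 d {{subst NonZero ω≡dE ω≢0}}
        nE≢0 : NonZero (n * E)
        nE≢0 = m*n≢0 n E
      -- b^(n·E) ≈ a^E is idempotent, so ω = d·E divides n·E
      ω∣nE : ω ∣ n * E
      ω∣nE = order-∣ regᵦ (Idem-resp (trans (sym (^-cong bⁿ≈a E)) (cong (_% m) (^-*-assoc b n E))) idem)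
      d∣n : d ∣ n
      d∣n = *-cancelʳ-∣ E (subst (_∣ n * E) ω≡dE ω∣nE)
      n′ : ℕ
      n′ = quotient d∣n
      n≡n′d : n ≡ n′ * d
      n≡n′d = m∣n⇒n≡quotient*m d∣n
      instance
        n′≢0 : NonZero n′
        n′≢0 = quotient≢0 d∣n
        n′d≢0 : NonZero (n′ * d)
        n′d≢0 = m*n≢0 n′ d
      u : ℕ
      u = proj₁ (bezout k ω)
      instance
        u≢0 : NonZero u
        u≢0 = proj₁ (proj₂ (bezout k ω))
        n′uk≢0 : NonZero (n′ * (u * k))
        n′uk≢0 = m*n≢0 n′ (u * k) {{n′≢0}} {{m*n≢0 u k}}
      uk≈d : u * k ≋ d [mod ω ]
      uk≈d = proj₂ (proj₂ (bezout k ω))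

  -- Translation from the notions of the statement (residues in ℤ_m = {1,…,m},
  -- idempotents and orders via the representative modZ) to the ones above.

  modZ≈ : ∀ t → modZ m t ≈ t
  modZ≈ t with t % m in t%m
  ... | zero  = n%n≡0 m
  ... | suc ρ = m<n⇒m%n≡m (subst (_< m) t%m (m%n<n t m))

  modZ-InZ : ∀ t → InZ m (modZ m t)
  modZ-InZ t with t % m in t%m
  ... | zero  = >-nonZero⁻¹ m , ≤-refl
  ... | suc ρ = s≤s z≤n , <⇒≤ (subst (_< m) t%m (m%n<n t m))

  InE⇒Idem : ∀ t → InE m (modZ m t) → Idem t
  InE⇒Idem t (_ , idem) = Idem-resp (modZ≈ t) idem

  Idem⇒InE : ∀ t → Idem t → InE m (modZ m t)
  Idem⇒InE t idem = modZ-InZ t , Idem-resp (sym (modZ≈ t)) idem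

  IsOrder⇒HasOrder : ∀ {c o} → IsOrder m c o → HasOrder c o
  IsOrder⇒HasOrder {c} (o≥1 , inE , below) = record
    { positive = >-nonZero o≥1
    ; holds = InE⇒Idem _ inE
    ; below = λ j j<o idem → below j (>-nonZero⁻¹ j) j<o (Idem⇒InE _ idem) }

  IsOrder⇒Regular : ∀ {c o} → IsOrder m c o → c ^ (o + 1) ≋ c [mod m ] → Regular c o
  IsOrder⇒Regular {c} {o} ord per = record
    { hasOrder = IsOrder⇒HasOrder ord
    ; isPeriodic = periodic (trans (cong (λ e → c ^ e % m) (+-comm 1 o)) per) }

  Regular-resp : ∀ {c c′ o} → c ≈ c′ → Regular c o → Regular c′ o
  Regular-resp {c} {c′} {o} c≈c′ reg = record
    { hasOrder = record
      { positive = positive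
      ; holds = Idem-resp (^-cong c≈c′ o) holds
      ; below = λ j j<o idem → below j j<o (Idem-resp (sym (^-cong c≈c′ j)) idem) }
    ; isPeriodic = periodic-resp c≈c′ isPeriodic }
    where open Regular reg

  Regular⇒IsOrder : ∀ {c o} → Regular c o → IsOrder m c o
  Regular⇒IsOrder reg = >-nonZero⁻¹ _ , Idem⇒InE _ holds , λ j j≥1 j<o inE → below j {{>-nonZero j≥1}} j<o (InE⇒Idem _ inE)
    where open Regular reg

  Maximal-from-ω : ∀ {a ω} → (∀ n → InOmegaSet m a n → n ≤ ω) → Maximal a ω
  Maximal-from-ω {a} max {c} {o} reg (t , t≢0 , cᵗ≈a) =
    max o (modZ m c , (modZ-InZ c , o , ord , trans (cong (λ e → modZ m c ^ e % m) (+-comm o 1)) period)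
                    , (t , >-nonZero⁻¹ t {{t≢0}} , trans (^-cong (modZ≈ c) t) cᵗ≈a) , ord)
    where
      reg′ : Regular (modZ m c) o
      reg′ = Regular-resp (sym (modZ≈ c)) reg
      ord : IsOrder m (modZ m c) o
      ord = Regular⇒IsOrder reg′
      open Periodic (Regular.isPeriodic reg′)

theorem3p2 : (m : ℕ) → .{{_ : NonZero m}} → (a : ℕ) → InR m a →
    (k : ℕ) → .{{_ : NonZero k}} → (w : ℕ) → IsPrimOrder m a w →
    (Σ ℕ (λ x → InZ m x × (x ^ k ≋ a [mod m ])))
      ⇔ InE m (modZ m (a ^ expo k w))
theorem3p2 m a (_ , n₀ , ordₐ , perₐ) k w ((b , (_ , n₁ , ordᵦ , perᵦ) , (n , n≥1 , bⁿ≈a) , ordᵦʷ) , max) =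
  mk⇔ (λ (x , _ , xᵏ≈a) → Idem⇒InE _ (root⇒idempotent {n = n} {x = x} {k = k} (Maximal-from-ω max)
                                        regᵦ bⁿ≈a (Regular.isPeriodic regₐ) xᵏ≈a))
      (λ inE → representative (idempotent⇒root {n = n} {k = k} regᵦ bⁿ≈a (InE⇒Idem _ inE)))
  where
    open Residues m
    instance
      n≢0 : NonZero n
      n≢0 = >-nonZero n≥1
      d≢0 : NonZero (gcd k w)
      d≢0 = ≢-nonZero (gcd[m,n]≢0 k w (inj₁ (≢-nonZero⁻¹ k)))
    regₐ : Regular a n₀
    regₐ = IsOrder⇒Regular ordₐ perₐ
    instance
      n₀≢0 : NonZero n₀
      n₀≢0 = Regular.positive regₐ
    regᵦ : Regular b w
    regᵦ = subst (Regular b) (least-unique (IsOrder⇒HasOrder ordᵦ) (IsOrder⇒HasOrder ordᵦʷ))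
                 (IsOrder⇒Regular ordᵦ perᵦ)
    representative : (∃ λ x → x ^ k ≈ a) → Σ ℕ (λ x → InZ m x × (x ^ k ≋ a [mod m ]))
    representative (x , xᵏ≈a) = modZ m x , modZ-InZ x , trans (^-cong (modZ≈ x) k) xᵏ≈a
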